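{- Let $E$ be an admissible $A$-module scheme over $S$. Let $n\ge0$ and $a\in\mathfrak p^n$, and write $\varphi_E(a)=\sum_{j\ge0}\alpha_j\tau^j$. Then $\alpha_j\in\mathfrak p^{\,n-j}R$ for all $j\ge0$ (where $\mathfrak p^{k}R=R$ for $k\le0$).
   Context: Let $q=p^h$, $A=\mathcal O(X\setminus\{\infty\})$ for a projective, geometrically connected, smooth curve $X$ over $\mathbb F_q$ and $\infty\in X(\mathbb F_q)$; $\mathfrak p\subset A$ a maximal ideal, $\hat A$ the $\mathfrak p$-adic completion, $t\in\mathfrak p\setminus\mathfrak p^2$ with image $\pi\in\hat A$. $R$ is an $\hat A$-algebra which is $\pi$-adically complete and $\pi$-torsion free, $\theta:A\to R$ the structure map, $S=\mathrm{Spf}R$; $\mathfrak p^kR$ is the ideal of $R$ generated by the image of $\mathfrak p^k$ (equal to $\pi^kR$). $R\{\tau\}^\wedge$ is the set of sums $\sum_{i\ge0}b_i\tau^i$ with $b_i\in R$, $b_i\to0$ $\pi$-adically, acting on $\hat{\mathbb G}_a=\mathrm{Spf}R\langle x\rangle$ by $x\mapsto\sum b_ix^{q^i}$, composition $b\tau^i\circ c\tau^j=bc^{q^i}\tau^{i+j}$. An admissible $A$-module scheme over $S$ is $\hat{\mathbb G}_a$ with a ring homomorphism $\varphi_E:A\to R\{\tau\}^\wedge$ such that the $\tau^0$-coefficient of $\varphi_E(a)$ is $\theta(a)$ for all $a\in A$. -}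

module Defs where

open import Level using (0ℓ)
open import Data.Nat as ℕ using (ℕ; zero; suc; _≤_; _∸_)
open import Data.Product using (Σ; ∃; _×_; _,_)
open import Relation.Nullary using (¬_)
open import Algebra.Bundles using (CommutativeRing)
open import Algebra.Morphism.Structures using (IsRingHomomorphism)

module RingNotions (Rg : CommutativeRing 0ℓ 0ℓ) where
  open CommutativeRing Rg hiding (zero)

  pow : Carrier → ℕ → Carrier
  pow x zero    = 1#
  pow x (suc n) = x * pow x n

  natCast : ℕ → Carrier
  natCast zero    = 0#
  natCast (suc n) = 1# + natCast n

  sumTo : ℕ → (ℕ → Carrier) → Carrier
  sumTo zero    f = f 0
  sumTo (suc k) f = sumTo k f + f (suc k)

  record IsIdeal (I : Carrier → Set) : Set where
    field
      resp   : ∀ {x y} → x ≈ y → I x → I y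
      zero-mem : I 0#
      +-closed : ∀ {x y} → I x → I y → I (x + y)
      *-closed : ∀ r {x} → I x → I (r * x)

  record IsMaximalIdeal (I : Carrier → Set) : Set where
    field
      isIdeal : IsIdeal I
      proper  : ¬ I 1#
      maximal : ∀ a → ¬ I a → ∃ λ b → I (1# + (- (a * b)))

  -- membership in the ideal power I^n (I^0 is the unit ideal): the ideal
  -- generated by the products x*y with x ∈ I, y ∈ I^(n-1)
  data PowIdeal (I : Carrier → Set) : ℕ → Carrier → Set where
    pow0  : ∀ x → PowIdeal I zero x
    gen   : ∀ {n x y} → I x → PowIdeal I n y → PowIdeal I (suc n) (x * y)
    zero∈ : ∀ {n} → PowIdeal I (suc n) 0#
    add   : ∀ {n x y} → PowIdeal I (suc n) x → PowIdeal I (suc n) y → PowIdeal I (suc n) (x + y)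
    smul  : ∀ {n} r {x} → PowIdeal I (suc n) x → PowIdeal I (suc n) (r * x)
    resp  : ∀ {n x y} → x ≈ y → PowIdeal I n x → PowIdeal I n y

  InPrincipalPow : Carrier → ℕ → Carrier → Set
  InPrincipalPow x N r = ∃ λ s → r ≈ pow x N * s

module Over (A R : CommutativeRing 0ℓ 0ℓ) (θ : CommutativeRing.Carrier A → CommutativeRing.Carrier R) where
  module A = CommutativeRing A
  module R = CommutativeRing R
  open RingNotions A using (PowIdeal)
  open RingNotions R using (pow; sumTo; InPrincipalPow; natCast)

  -- 𝔭^k R : the ideal of R generated by θ(𝔭^k)
  data ExtIdeal (𝔭 : A.Carrier → Set) (k : ℕ) : R.Carrier → Set where
    gen   : ∀ r {a} → PowIdeal 𝔭 k a → ExtIdeal 𝔭 k (r R.* θ a)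
    zero∈ : ExtIdeal 𝔭 k R.0#
    add   : ∀ {x y} → ExtIdeal 𝔭 k x → ExtIdeal 𝔭 k y → ExtIdeal 𝔭 k (x R.+ y)
    resp  : ∀ {x y} → x R.≈ y → ExtIdeal 𝔭 k x → ExtIdeal 𝔭 k y

  -- elements of R{τ}^ are coefficient sequences b : ℕ → R (b i is the τ^i coefficient)
  SkewSeries : Set
  SkewSeries = ℕ → R.Carrier

  ConvergesToZero : R.Carrier → SkewSeries → Set
  ConvergesToZero π b = ∀ N → ∃ λ M → ∀ i → M ≤ i → InPrincipalPow π N (b i)

  -- composition: (Σ b_i τ^i) ∘ (Σ c_j τ^j) has τ^k coefficient Σ_{i+j=k} b_i c_j^{q^i}
  compose : ℕ → SkewSeries → SkewSeries → SkewSeries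
  compose q b c k = sumTo k (λ i → b i R.* pow (c (k ∸ i)) (q ℕ.^ i))

  addS : SkewSeries → SkewSeries → SkewSeries
  addS b c i = b i R.+ c i

  oneS : SkewSeries
  oneS zero    = R.1#
  oneS (suc i) = R.0#

  _≈S_ : SkewSeries → SkewSeries → Set
  b ≈S c = ∀ i → b i R.≈ c i

  record IsSkewRingHom (q : ℕ) (π : R.Carrier) (φ : A.Carrier → SkewSeries) : Set where
    field
      converges : ∀ a → ConvergesToZero π (φ a)
      φ-cong    : ∀ {a b} → a A.≈ b → φ a ≈S φ b
      φ-+       : ∀ a b → φ (a A.+ b) ≈S addS (φ a) (φ b)
      φ-*       : ∀ a b → φ (a A.* b) ≈S compose q (φ a) (φ b)
      φ-1       : φ A.1# ≈S oneS

  -- admissible A-module scheme over S = Spf R: τ^0-coefficient of φ(a) is θ(a)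
  record IsAdmissible (q : ℕ) (π : R.Carrier) (φ : A.Carrier → SkewSeries) : Set where
    field
      isHom    : IsSkewRingHom q π φ
      constant : ∀ a → φ a 0 R.≈ θ a

module Submission where

-- Call a skew series c = Σ cⱼ τʲ "filtered of level n" when cⱼ ∈ 𝔭^(n∸j) R
-- for every j.  The proof is an induction over the derivation of a ∈ 𝔭ⁿ,
-- using two estimates for the composite b ∘ c, whose τʲ-coefficient is
-- Σ_{i ≤ j} bᵢ · c_{j-i}^(q^i):
--   * if c is filtered of level n, so is b ∘ c (every summand is a multiple
--     of a positive power of some c_{j-i} ∈ 𝔭^(n∸(j-i)) R ⊆ 𝔭^(n∸j) R);
--   * if moreover b₀ = θ(x) with x ∈ 𝔭, then b ∘ c is filtered of level n+1
--     (the summand i = 0 is θ(x)·cⱼ, the summands i ≥ 1 lose one τ-degree).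
-- Since φ(x·y) = φ(x) ∘ φ(y) and φ(x)₀ = θ(x) for an admissible module,
-- the generators x·y (x ∈ 𝔭, y ∈ 𝔭ⁿ) of 𝔭ⁿ⁺¹ are handled by the second
-- estimate, multiples r·y by the first, and sums by additivity of φ.

open import Defs
open import Level using (0ℓ)
open import Data.Nat using (ℕ; zero; suc; _^_; _≤_; _<_; _∸_; _≤′_; ≤′-refl; ≤′-step; z≤n; s≤s; >-nonZero; nonTrivial⇒nonZero)
open import Data.Nat.Primality using (Prime; prime)
open import Data.Nat.Properties
  using (m^n>0; ≤⇒≤′; ≤-trans; ≤-refl; n≤1+n; m∸n≤m; ∸-monoʳ-≤; +-∸-assoc; m≤n⇒m∸n≡0; 0∸n≡0; ≰⇒>; _≤?_)
open import Data.Product using (∃)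
open import Relation.Nullary using (¬_; yes; no)
open import Relation.Binary.PropositionalEquality using (subst; sym)
open import Algebra.Bundles using (CommutativeRing)
open import Algebra.Morphism.Structures using (IsRingHomomorphism)
import Algebra.Properties.Ring as RingProperties
import Relation.Binary.Reasoning.Setoid as SetoidReasoning

prime-power-positive : ∀ {p} → Prime p → ∀ h → 0 < p ^ h
prime-power-positive {p} (prime {{nt}} _) h =
  m^n>0 p {{nonTrivial⇒nonZero p {{nt}}}} h

module PowIdealChain (A : CommutativeRing 0ℓ 0ℓ) (𝔭 : CommutativeRing.Carrier A → Set) where
  open RingNotions A

  PowIdeal-pred : ∀ {n x} → PowIdeal 𝔭 (suc n) x → PowIdeal 𝔭 n x
  PowIdeal-pred {zero}  _            = pow0 _
  PowIdeal-pred {suc n} (gen px py)  = gen px (PowIdeal-pred py)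
  PowIdeal-pred {suc n} zero∈        = zero∈
  PowIdeal-pred {suc n} (add x y)    = add (PowIdeal-pred x) (PowIdeal-pred y)
  PowIdeal-pred {suc n} (smul r x)   = smul r (PowIdeal-pred x)
  PowIdeal-pred {suc n} (resp e x)   = resp e (PowIdeal-pred x)

  PowIdeal-mono : ∀ {k k′ x} → k ≤ k′ → PowIdeal 𝔭 k′ x → PowIdeal 𝔭 k x
  PowIdeal-mono le = go (≤⇒≤′ le)
    where
    go : ∀ {k k′ x} → k ≤′ k′ → PowIdeal 𝔭 k′ x → PowIdeal 𝔭 k x
    go ≤′-refl       d = d
    go (≤′-step le′) d = go le′ (PowIdeal-pred d)

module ExtendedIdeals (A R : CommutativeRing 0ℓ 0ℓ)
  (θ : CommutativeRing.Carrier A → CommutativeRing.Carrier R)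
  (θ-hom : IsRingHomomorphism (CommutativeRing.rawRing A) (CommutativeRing.rawRing R) θ)
  (𝔭 : CommutativeRing.Carrier A → Set) where
  open Over A R θ
  private
    module NA = RingNotions A
    module NR = RingNotions R
  open IsRingHomomorphism θ-hom using (1#-homo; *-homo)
  open PowIdealChain A 𝔭 using (PowIdeal-mono)
  open SetoidReasoning R.setoid

  Ext-zero-level : ∀ x → ExtIdeal 𝔭 0 x
  Ext-zero-level x =
    resp (R.trans (R.*-congˡ 1#-homo) (R.*-identityʳ x)) (gen x (NA.pow0 A.1#))

  Ext-mono : ∀ {k k′ x} → k ≤ k′ → ExtIdeal 𝔭 k′ x → ExtIdeal 𝔭 k x
  Ext-mono le (gen r pa) = gen r (PowIdeal-mono le pa)
  Ext-mono le zero∈      = zero∈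
  Ext-mono le (add x y)  = add (Ext-mono le x) (Ext-mono le y)
  Ext-mono le (resp e x) = resp e (Ext-mono le x)

  Ext-*ˡ : ∀ {k x} r → ExtIdeal 𝔭 k x → ExtIdeal 𝔭 k (r R.* x)
  Ext-*ˡ r (gen r′ pa) = resp (R.*-assoc _ _ _) (gen (r R.* r′) pa)
  Ext-*ˡ r zero∈       = resp (R.sym (R.zeroʳ r)) zero∈
  Ext-*ˡ r (add x y)   = resp (R.sym (R.distribˡ r _ _)) (add (Ext-*ˡ r x) (Ext-*ˡ r y))
  Ext-*ˡ r (resp e x)  = resp (R.*-congˡ e) (Ext-*ˡ r x)

  Ext-pow : ∀ {k x} m → 0 < m → ExtIdeal 𝔭 k x → ExtIdeal 𝔭 k (NR.pow x m)
  Ext-pow (suc m) _ e = resp (R.*-comm _ _) (Ext-*ˡ (NR.pow _ m) e)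

  Ext-sum : ∀ {k} j (f : ℕ → R.Carrier) →
            (∀ i → i ≤ j → ExtIdeal 𝔭 k (f i)) → ExtIdeal 𝔭 k (NR.sumTo j f)
  Ext-sum zero    f mem = mem 0 z≤n
  Ext-sum (suc j) f mem =
    add (Ext-sum j f (λ i le → mem i (≤-trans le (n≤1+n j)))) (mem (suc j) ≤-refl)

  Ext-θ : ∀ {k x y} → 𝔭 x → ExtIdeal 𝔭 k y → ExtIdeal 𝔭 (suc k) (θ x R.* y)
  Ext-θ {x = x} px (gen r {a} pa) = resp reassoc (gen r (NA.gen px pa))
    where
    reassoc : r R.* θ (x A.* a) R.≈ θ x R.* (r R.* θ a)
    reassoc = begin
      r R.* θ (x A.* a)     ≈⟨ R.*-congˡ (*-homo x a) ⟩
      r R.* (θ x R.* θ a)   ≈⟨ R.sym (R.*-assoc _ _ _) ⟩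
      (r R.* θ x) R.* θ a   ≈⟨ R.*-congʳ (R.*-comm _ _) ⟩
      (θ x R.* r) R.* θ a   ≈⟨ R.*-assoc _ _ _ ⟩
      θ x R.* (r R.* θ a)   ∎
  Ext-θ px zero∈      = resp (R.sym (R.zeroʳ _)) zero∈
  Ext-θ px (add a b)  = resp (R.sym (R.distribˡ _ _ _)) (add (Ext-θ px a) (Ext-θ px b))
  Ext-θ px (resp e a) = resp (R.*-congˡ e) (Ext-θ px a)

module SkewHomZero (A R : CommutativeRing 0ℓ 0ℓ)
  (θ : CommutativeRing.Carrier A → CommutativeRing.Carrier R)
  (q : ℕ) (π : CommutativeRing.Carrier R)
  (φ : CommutativeRing.Carrier A → Over.SkewSeries A R θ)
  (φ-hom : Over.IsSkewRingHom A R θ q π φ) where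
  private
    module A = CommutativeRing A
    module R = CommutativeRing R
  open Over.IsSkewRingHom φ-hom using (φ-+; φ-cong)
  open RingProperties R.ring using (+-identityʳ-unique)

  φ-zero : ∀ j → φ A.0# j R.≈ R.0#
  φ-zero j = +-identityʳ-unique (φ A.0# j) (φ A.0# j)
    (R.trans (R.sym (φ-+ A.0# A.0# j)) (φ-cong (A.+-identityʳ A.0#) j))

module Filtration (A R : CommutativeRing 0ℓ 0ℓ)
  (θ : CommutativeRing.Carrier A → CommutativeRing.Carrier R)
  (θ-hom : IsRingHomomorphism (CommutativeRing.rawRing A) (CommutativeRing.rawRing R) θ)
  (𝔭 : CommutativeRing.Carrier A → Set)
  (q : ℕ) (q>0 : 0 < q) (π : CommutativeRing.Carrier R)
  (φ : CommutativeRing.Carrier A → Over.SkewSeries A R θ)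
  (admissible : Over.IsAdmissible A R θ q π φ) where
  open Over A R θ
  private
    module NA = RingNotions A
    module NR = RingNotions R
  open IsAdmissible admissible
  open IsSkewRingHom isHom
  open ExtendedIdeals A R θ θ-hom 𝔭
  open SkewHomZero A R θ q π φ isHom using (φ-zero)

  Filtered : ℕ → SkewSeries → Set
  Filtered n c = ∀ j → ExtIdeal 𝔭 (n ∸ j) (c j)

  q^i>0 : ∀ i → 0 < q ^ i
  q^i>0 = m^n>0 q {{>-nonZero q>0}}

  summand-mem : ∀ {m n} (b c : SkewSeries) → Filtered n c →
                ∀ i j → m ∸ j ≤ n ∸ (j ∸ i) →
                ExtIdeal 𝔭 (m ∸ j) (b i R.* NR.pow (c (j ∸ i)) (q ^ i))
  summand-mem b c c-filt i j le =
    Ext-*ˡ (b i) (Ext-pow (q ^ i) (q^i>0 i) (Ext-mono le (c-filt (j ∸ i))))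

  compose-filtered : ∀ {n} (b c : SkewSeries) → Filtered n c → Filtered n (compose q b c)
  compose-filtered {n} b c c-filt j =
    Ext-sum j _ (λ i _ → summand-mem b c c-filt i j (∸-monoʳ-≤ n (m∸n≤m j i)))

  shifted-level : ∀ n j i → suc i ≤ j → suc n ∸ j ≤ n ∸ (j ∸ suc i)
  shifted-level n (suc j) i (s≤s _) = ∸-monoʳ-≤ n (m∸n≤m j i)

  compose-filtered-suc : ∀ {n x} (b c : SkewSeries) → b 0 R.≈ θ x → 𝔭 x →
                         Filtered n c → Filtered (suc n) (compose q b c)
  compose-filtered-suc {n} {x} b c b₀≈θx px c-filt j = Ext-sum j _ summand
    where
    summand : ∀ i → i ≤ j → ExtIdeal 𝔭 (suc n ∸ j) (b i R.* NR.pow (c (j ∸ i)) (q ^ i))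
    summand (suc i) le = summand-mem b c c-filt (suc i) j (shifted-level n j i le)
    -- i = 0: b₀·cⱼ = θ(x)·cⱼ ∈ 𝔭^(n∸j+1) R, which is 𝔭^((n+1)∸j) R when j ≤ n
    -- and the unit ideal otherwise.
    summand zero    _  with j ≤? n
    ... | yes j≤n = subst (λ k → ExtIdeal 𝔭 k (b 0 R.* (c j R.* R.1#))) (sym (+-∸-assoc 1 j≤n))
                      (resp (R.*-congʳ (R.sym b₀≈θx))
                        (Ext-θ px (resp (R.sym (R.*-identityʳ _)) (c-filt j))))
    ... | no j≰n  = subst (λ k → ExtIdeal 𝔭 k (b 0 R.* (c j R.* R.1#)))
                      (sym (m≤n⇒m∸n≡0 (≰⇒> j≰n))) (Ext-zero-level _)

  φ-filtered : ∀ n a → NA.PowIdeal 𝔭 n a → Filtered n (φ a)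
  φ-filtered _ a (NA.pow0 _) j =
    subst (λ k → ExtIdeal 𝔭 k (φ a j)) (sym (0∸n≡0 j)) (Ext-zero-level _)
  φ-filtered _ _ (NA.gen {n} {x} {y} px py) j =
    resp (R.sym (φ-* x y j))
      (compose-filtered-suc (φ x) (φ y) (constant x) px (φ-filtered n y py) j)
  φ-filtered _ _ NA.zero∈ j = resp (R.sym (φ-zero j)) zero∈
  φ-filtered _ _ (NA.add {x = x} {y} px py) j =
    resp (R.sym (φ-+ x y j)) (add (φ-filtered _ x px j) (φ-filtered _ y py j))
  φ-filtered _ _ (NA.smul r {x} px) j =
    resp (R.sym (φ-* r x j)) (compose-filtered (φ r) (φ x) (φ-filtered _ x px) j)
  φ-filtered n _ (NA.resp {x = x} e px) j = resp (φ-cong e j) (φ-filtered n x px j)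

proposition5p7 :
  (A R : CommutativeRing 0ℓ 0ℓ) →
  let module A = CommutativeRing A
      module R = CommutativeRing R
      module NA = RingNotions A
      module NR = RingNotions R
  in
  (p h : ℕ) → Prime p → 1 ≤ h →
  NA.natCast p A.≈ A.0# →
  NR.natCast p R.≈ R.0# →
  (θ : A.Carrier → R.Carrier) →
  IsRingHomomorphism A.rawRing R.rawRing θ →
  (𝔭 : A.Carrier → Set) → NA.IsMaximalIdeal 𝔭 →
  (t : A.Carrier) → 𝔭 t → ¬ NA.PowIdeal 𝔭 2 t →
  (∀ r → θ t R.* r R.≈ R.0# → r R.≈ R.0#) →
  (∀ r → (∀ N → NR.InPrincipalPow (θ t) N r) → r R.≈ R.0#) →
  (∀ (x : ℕ → R.Carrier) →
     (∀ k → NR.InPrincipalPow (θ t) k (x (Data.Nat.suc k) R.+ R.- (x k))) →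
     ∃ λ y → ∀ k → NR.InPrincipalPow (θ t) k (y R.+ R.- (x k))) →
  (φ : A.Carrier → Over.SkewSeries A R θ) →
  Over.IsAdmissible A R θ (p ^ h) (θ t) φ →
  (n : ℕ) (a : A.Carrier) → NA.PowIdeal 𝔭 n a →
  ∀ j → Over.ExtIdeal A R θ 𝔭 (n ∸ j) (φ a j)
proposition5p7 A R p h p-prime _ _ _ θ θ-hom 𝔭 _ t _ _ _ _ _ φ admissible =
  Filtration.φ-filtered A R θ θ-hom 𝔭 (p ^ h) (prime-power-positive p-prime h) (θ t) φ admissible
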